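{- Let $G$ be a connected graph of order at least $2$ and let $u\in V(G)$. Then $$\xi^{ - }(G) \le \xi_G(u) \le \xi(G)\le {\rm gp}(G) \leq 2\xi^{ - }(G)\,.$$
   Context: All graphs are finite, simple and connected. For vertices $x,y$ of $G$, $d_G(x,y)$ is the length of a shortest $x,y$-path and $I_G[x,y]=\{w: d_G(x,y)=d_G(x,w)+d_G(w,y)\}$. A set $X\subseteq V(G)$ is a general position set if every shortest path $P$ of $G$ satisfies $|V(P)\cap X|\le 2$; ${\rm gp}(G)$ is the maximum cardinality of a general position set of $G$. For $u\in V(G)$, a set $S\subseteq V(G)$ is $u$-colinear if $S$ is a general position set, $u\notin S$, and $y\notin I_G[x,u]$ for all $x,y\in S$ (with $x \neq y$). $\xi_G(u)$ is the maximum cardinality of a $u$-colinear set, $\xi^{ - }(G)=\min_{u\in V(G)}\xi_G(u)$ and $\xi(G)=\max_{u\in V(G)}\xi_G(u)$. -}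

module Defs where

open import Data.Nat using (ℕ; zero; suc; _≤_)
open import Data.Fin using (Fin)
open import Data.Fin.Subset using (Subset; _∈_; _∉_; ∣_∣; _∩_; _∪_; ⁅_⁆)
open import Data.Vec using (Vec; []; _∷_; head; last)
open import Data.Product using (Σ; _×_; ∃; ∃-syntax)
open import Relation.Binary.PropositionalEquality using (_≡_; _≢_)
open import Relation.Nullary using (¬_)
open import Level using (0ℓ; suc)

record Graph (n : ℕ) : Set₁ where
  field
    Adj   : Fin n → Fin n → Set
    sym   : ∀ {x y} → Adj x y → Adj y x
    irrefl : ∀ x → ¬ Adj x x
open Graph public

module _ {n : ℕ} (G : Graph n) where

  -- A walk with k edges, given by its vertex sequence v₀ … v_k.
  data IsWalk : {k : ℕ} → Vec (Fin n) (ℕ.suc k) → Set where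
    single : (x : Fin n) → IsWalk (x ∷ [])
    cons   : (x : Fin n) {y : Fin n} {k : ℕ} {vs : Vec (Fin n) k} →
             Adj G x y → IsWalk (y ∷ vs) → IsWalk (x ∷ y ∷ vs)

  HasWalk : Fin n → Fin n → ℕ → Set
  HasWalk x y k = Σ (Vec (Fin n) (ℕ.suc k)) λ v → IsWalk v × head v ≡ x × last v ≡ y

  Connected : Set
  Connected = ∀ x y → ∃[ k ] HasWalk x y k

  Dist : Fin n → Fin n → ℕ → Set
  Dist x y k = HasWalk x y k × (∀ m → HasWalk x y m → k ≤ m)

  IsShortestPath : {k : ℕ} → Vec (Fin n) (ℕ.suc k) → Set
  IsShortestPath {k} v = IsWalk v × Dist (head v) (last v) k

  vertices : {m : ℕ} → Vec (Fin n) m → Subset n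
  vertices []       = Data.Fin.Subset.⊥
  vertices (x ∷ vs) = ⁅ x ⁆ ∪ vertices vs

  InInterval : Fin n → Fin n → Fin n → Set
  InInterval x y w = ∀ a b c → Dist x y a → Dist x w b → Dist w y c → a ≡ b Data.Nat.+ c

  IsGeneralPosition : Subset n → Set
  IsGeneralPosition X =
    ∀ (k : ℕ) (P : Vec (Fin n) (ℕ.suc k)) → IsShortestPath P → ∣ vertices P ∩ X ∣ ≤ 2

  IsColinear : Fin n → Subset n → Set
  IsColinear u S = IsGeneralPosition S × u ∉ S ×
    (∀ x y → x ∈ S → y ∈ S → x ≢ y → ¬ InInterval x u y)

  IsMaxCard : (Subset n → Set) → ℕ → Set
  IsMaxCard P k = (∃[ S ] (P S × ∣ S ∣ ≡ k)) × (∀ S → P S → ∣ S ∣ ≤ k)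

  IsGp : ℕ → Set
  IsGp = IsMaxCard IsGeneralPosition

  IsXiAt : Fin n → ℕ → Set
  IsXiAt u = IsMaxCard (IsColinear u)

  IsXiMinus : ℕ → Set
  IsXiMinus k = (∃[ u ] IsXiAt u k) × (∀ u j → IsXiAt u j → k ≤ j)

  IsXi : ℕ → Set
  IsXi k = (∃[ u ] IsXiAt u k) × (∀ u j → IsXiAt u j → j ≤ k)

{-# OPTIONS --safe #-}
-- Only gp(G) ≤ 2ξ⁻(G) needs an argument.  Fix u with ξ_G(u) = ξ⁻(G) and a maximum general
-- position set X, and call x ∈ X ∖ {u} blocked if some z ∈ X ∖ {u, x} lies in I[x,u].  The
-- unblocked points form a u-colinear set by definition.  So do the blocked ones: if y ∈ I[x,u]
-- is blocked by z, then y ∈ I[x,z], which puts three points of X on one shortest path.  For the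
-- same reason no point is blocked when u ∈ X, so X is covered by the unblocked points together
-- with either the blocked points or {u}, each of size at most ξ⁻(G).
--
-- Adjacency is an arbitrary relation, so distances exist only classically; since the final
-- inequality between naturals is decidable, the argument runs in the double-negation monad.
module Submission where

open import Defs hiding (sym)
open import Data.Nat using (ℕ; _≤_; _*_; suc; _+_; _<_; z≤n; s≤s; _≤?_)
import Data.Nat as ℕ
open import Data.Nat.Properties hiding (_≟_)
open import Data.Nat.Induction using (<-rec)
open import Data.Fin using (Fin; _≟_; zero; punchIn)
open import Data.Fin.Properties using (any?; sequence; punchInᵢ≢i)
open import Data.Fin.Subset using (Subset; _∈_; _∉_; _⊆_; ∣_∣; _∩_; _∪_; _-_; ⁅_⁆; inside; outside)
open import Data.Fin.Subset.Properties
open import Data.Vec using (Vec; []; _∷_; _++_; head; last; tail; tabulate)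
open import Data.Vec.Properties using (lookup∘tabulate; []=⇒lookup; lookup⇒[]=)
open import Data.Bool using (true)
open import Data.Product using (Σ; ∃-syntax; _×_; _,_; proj₁; proj₂)
open import Data.Sum using (inj₁; inj₂)
open import Effect.Monad using (RawMonad)
open import Function using (_∘_)
open import Level using (0ℓ)
open import Relation.Nullary using (¬_; Dec; yes; no; does; ¬?; _×-dec_)
open import Relation.Nullary.Decidable using (dec-true; decidable-stable; ¬¬-excluded-middle)
open import Relation.Nullary.Negation using (¬¬-Monad; ¬¬-map; contradiction)
open import Relation.Unary using (Pred; Decidable)
open import Relation.Binary.PropositionalEquality

open RawMonad (¬¬-Monad {0ℓ}) using (pure; _>>=_; _<$>_; rawApplicative)

¬¬-least : {P : ℕ → Set} (k : ℕ) → P k → ¬ ¬ (∃[ m ] (P m × (∀ j → P j → m ≤ j)))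
¬¬-least {P} = <-rec (λ k → P k → ¬ ¬ Least) step
  where
  Least : Set
  Least = ∃[ m ] (P m × (∀ j → P j → m ≤ j))
  step : ∀ k → (∀ {j} → j < k → P j → ¬ ¬ Least) → P k → ¬ ¬ Least
  step k smaller pk = ¬¬-excluded-middle {A = ∃[ j ] (j < k × P j)} >>= λ where
    (yes (j , j<k , pj)) → smaller j<k pj
    (no ∄j) → pure (k , pk , λ j pj → ≮⇒≥ (λ j<k → ∄j (j , j<k , pj)))

select : ∀ {n ℓ} {P : Pred (Fin n) ℓ} → Decidable P → Subset n
select P? = tabulate (λ i → does (P? i))

module _ {n ℓ} {P : Pred (Fin n) ℓ} (P? : Decidable P) where

  ∈-select⁺ : ∀ {i} → P i → i ∈ select P?
  ∈-select⁺ {i} p = lookup⇒[]= i (select P?) (trans (lookup∘tabulate _ i) (dec-true (P? i) p))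

  ∈-select⁻ : ∀ {i} → i ∈ select P? → P i
  ∈-select⁻ {i} i∈ = witness (P? i) (trans (sym (lookup∘tabulate _ i)) ([]=⇒lookup i∈))
    where
    witness : {A : Set ℓ} (A? : Dec A) → does A? ≡ true → A
    witness (yes a) _ = a
    witness (no _) ()

∣p∪q∣≤∣p∣+∣q∣ : ∀ {n} (p q : Subset n) → ∣ p ∪ q ∣ ≤ ∣ p ∣ + ∣ q ∣
∣p∪q∣≤∣p∣+∣q∣ []            []            = z≤n
∣p∪q∣≤∣p∣+∣q∣ (inside ∷ p)  (s ∷ q)       =
  s≤s (≤-trans (∣p∪q∣≤∣p∣+∣q∣ p q) (+-monoʳ-≤ ∣ p ∣ (∣p∣≤∣x∷p∣ s q)))
∣p∪q∣≤∣p∣+∣q∣ (outside ∷ p) (inside ∷ q)  =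
  subst (suc ∣ p ∪ q ∣ ≤_) (sym (+-suc ∣ p ∣ ∣ q ∣)) (s≤s (∣p∪q∣≤∣p∣+∣q∣ p q))
∣p∪q∣≤∣p∣+∣q∣ (outside ∷ p) (outside ∷ q) = ∣p∪q∣≤∣p∣+∣q∣ p q

p⊆q∪r⇒∣p∣≤∣q∣+∣r∣ : ∀ {n} {p : Subset n} (q r : Subset n) → p ⊆ q ∪ r → ∣ p ∣ ≤ ∣ q ∣ + ∣ r ∣
p⊆q∪r⇒∣p∣≤∣q∣+∣r∣ q r p⊆q∪r = ≤-trans (p⊆q⇒∣p∣≤∣q∣ p⊆q∪r) (∣p∪q∣≤∣p∣+∣q∣ q r)

x,y,z∈p⇒3≤∣p∣ : ∀ {n} {p : Subset n} {x y z} → x ∈ p → y ∈ p → z ∈ p →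
                x ≢ y → y ≢ z → x ≢ z → 3 ≤ ∣ p ∣
x,y,z∈p⇒3≤∣p∣ {p = p} {x} {y} {z} x∈p y∈p z∈p x≢y y≢z x≢z =
  ≤-trans (s≤s 2≤∣p-z∣) (x∈p⇒∣p-x∣<∣p∣ z∈p)
  where
  1≤∣p-z-y∣ : 1 ≤ ∣ p - z - y ∣
  1≤∣p-z-y∣ = ≤-trans (s≤s z≤n) (x∈p⇒∣p-x∣<∣p∣ (x∈p∧x≢y⇒x∈p-y (x∈p∧x≢y⇒x∈p-y x∈p x≢z) x≢y))
  2≤∣p-z∣ : 2 ≤ ∣ p - z ∣
  2≤∣p-z∣ = ≤-trans (s≤s 1≤∣p-z-y∣) (x∈p⇒∣p-x∣<∣p∣ (x∈p∧x≢y⇒x∈p-y y∈p y≢z))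

last-++-tail : ∀ {a} {A : Set a} {k l} (v : Vec A (suc k)) (w : Vec A (suc l)) →
               last v ≡ head w → last (v ++ tail w) ≡ last w
last-++-tail (x ∷ [])     (.x ∷ ws) refl = refl
last-++-tail (x ∷ y ∷ vs) w         e    = last-++-tail (y ∷ vs) w e

module _ {n : ℕ} (G : Graph n) where

  walk-++ : ∀ {k l} {v : Vec (Fin n) (suc k)} {w : Vec (Fin n) (suc l)} →
            IsWalk G v → IsWalk G w → last v ≡ head w → IsWalk G (v ++ tail w)
  walk-++ {w = y ∷ ws} (single .y)  w-walk refl = w-walk
  walk-++              (cons x a v) w-walk e    = cons x a (walk-++ v w-walk e)

  hasWalk-trans : ∀ {x y z a b} → HasWalk G x y a → HasWalk G y z b → HasWalk G x z (a + b)
  hasWalk-trans (x ∷ vs , v-walk , refl , v-last) (w , w-walk , w-head , refl) =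
    x ∷ vs ++ tail w , walk-++ v-walk w-walk link , refl , last-++-tail (x ∷ vs) w link
    where
    link : last (x ∷ vs) ≡ head w
    link = trans v-last (sym w-head)

  hasWalk-0 : ∀ {x y} → HasWalk G x y 0 → x ≡ y
  hasWalk-0 (_ ∷ [] , _ , refl , refl) = refl

  head∈vertices : ∀ {k} (v : Vec (Fin n) (suc k)) → head v ∈ vertices G v
  head∈vertices (x ∷ _) = x∈p∪q⁺ (inj₁ (x∈⁅x⁆ x))

  last∈vertices : ∀ {k} (v : Vec (Fin n) (suc k)) → last v ∈ vertices G v
  last∈vertices (x ∷ [])     = x∈p∪q⁺ (inj₁ (x∈⁅x⁆ x))
  last∈vertices (_ ∷ y ∷ vs) = x∈p∪q⁺ (inj₂ (last∈vertices (y ∷ vs)))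

  vertices-++ˡ : ∀ {k l} (v : Vec (Fin n) k) (w : Vec (Fin n) l) → vertices G v ⊆ vertices G (v ++ w)
  vertices-++ˡ []       w i∈⊥ = contradiction i∈⊥ ∉⊥
  vertices-++ˡ (x ∷ vs) w i∈ with x∈p∪q⁻ ⁅ x ⁆ (vertices G vs) i∈
  ... | inj₁ i∈x  = x∈p∪q⁺ (inj₁ i∈x)
  ... | inj₂ i∈vs = x∈p∪q⁺ (inj₂ (vertices-++ˡ vs w i∈vs))

  gp-⊆ : ∀ {S X} → S ⊆ X → IsGeneralPosition G X → IsGeneralPosition G S
  gp-⊆ {S} {X} S⊆X gpX k P P-shortest = ≤-trans (p⊆q⇒∣p∣≤∣q∣ P∩S⊆P∩X) (gpX k P P-shortest)
    where
    P∩S⊆P∩X : vertices G P ∩ S ⊆ vertices G P ∩ X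
    P∩S⊆P∩X i∈ = let i∈P , i∈S = x∈p∩q⁻ (vertices G P) S i∈ in x∈p∩q⁺ (i∈P , S⊆X i∈S)

  gp-¬geodesic : ∀ {X x y z a b} → IsGeneralPosition G X → x ∈ X → y ∈ X → z ∈ X →
                x ≢ y → y ≢ z → x ≢ z →
                HasWalk G x y a → HasWalk G y z b → ¬ Dist G x z (a + b)
  gp-¬geodesic {X} {a = a} {b} gpX x∈X y∈X z∈X x≢y y≢z x≢z
              (x ∷ vs , v-walk , refl , v-last) (w , w-walk , refl , refl) xz-dist =
    <⇒≱ (x,y,z∈p⇒3≤∣p∣ (on-P x∈P x∈X) (on-P y∈P y∈X) (on-P z∈P z∈X) x≢y y≢z x≢z)
        (gpX _ P (walk-++ v-walk w-walk v-last , subst (λ t → Dist G x t _) (sym P-last) xz-dist))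
    where
    P : Vec (Fin n) (suc (a + b))
    P = x ∷ vs ++ tail w
    P-last : last P ≡ last w
    P-last = last-++-tail (x ∷ vs) w v-last
    on-P : ∀ {i} → i ∈ vertices G P → i ∈ X → i ∈ vertices G P ∩ X
    on-P i∈P i∈X = x∈p∩q⁺ (i∈P , i∈X)
    x∈P : x ∈ vertices G P
    x∈P = head∈vertices P
    y∈P : head w ∈ vertices G P
    y∈P = vertices-++ˡ (x ∷ vs) (tail w) (subst (_∈ vertices G (x ∷ vs)) v-last (last∈vertices (x ∷ vs)))
    z∈P : last w ∈ vertices G P
    z∈P = subst (_∈ vertices G P) P-last (last∈vertices P)

  DistanceFunction : Set
  DistanceFunction = Σ (Fin n → Fin n → ℕ) λ d → ∀ x y → Dist G x y (d x y)

  ¬¬-distance : Connected G → ¬ ¬ DistanceFunction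
  ¬¬-distance connected = choose <$> sequence rawApplicative λ x → sequence rawApplicative λ y →
    let k , walk = connected x y in ¬¬-least k walk
    where
    choose : (∀ x y → ∃[ k ] Dist G x y k) → DistanceFunction
    choose dist = (λ x y → proj₁ (dist x y)) , (λ x y → proj₂ (dist x y))

module Distance {n : ℕ} (G : Graph n) (d : Fin n → Fin n → ℕ) (d-dist : ∀ x y → Dist G x y (d x y)) where

  d-walk : ∀ x y → HasWalk G x y (d x y)
  d-walk x y = proj₁ (d-dist x y)

  d-triangle : ∀ x y z → d x z ≤ d x y + d y z
  d-triangle x y z = proj₂ (d-dist x z) _ (hasWalk-trans G (d-walk x y) (d-walk y z))

  d-refl : ∀ x → d x x ≡ 0
  d-refl x = n≤0⇒n≡0 (proj₂ (d-dist x x) 0 (x ∷ [] , single x , refl , refl))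

  d≡0⇒≡ : ∀ {x y} → d x y ≡ 0 → x ≡ y
  d≡0⇒≡ {x} {y} dxy≡0 = hasWalk-0 G (subst (HasWalk G x y) dxy≡0 (d-walk x y))

  Between : Fin n → Fin n → Fin n → Set
  Between x y z = d x z ≡ d x y + d y z

  between? : ∀ x y z → Dec (Between x y z)
  between? x y z = d x z ℕ.≟ d x y + d y z

  interval⇒between : ∀ {x y z} → InInterval G x z y → Between x y z
  interval⇒between {x} {y} {z} y∈I = y∈I _ _ _ (d-dist x z) (d-dist x y) (d-dist y z)

  between-distinct : ∀ {x y z} → Between x y z → x ≢ y → x ≢ z
  between-distinct {x} {y} xyz x≢y refl =
    x≢y (d≡0⇒≡ (m+n≡0⇒m≡0 (d x y) (trans (sym xyz) (d-refl x))))

  between-trans : ∀ {x y z u} → Between x y u → Between y z u → Between x y z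
  between-trans {x} {y} {z} {u} xyu yzu = ≤-antisym (d-triangle x y z) (+-cancelʳ-≤ (d z u) _ _ (begin
    d x y + d y z + d z u   ≡⟨ +-assoc (d x y) (d y z) (d z u) ⟩
    d x y + (d y z + d z u) ≡⟨ cong (d x y +_) yzu ⟨
    d x y + d y u           ≡⟨ xyu ⟨
    d x u                   ≤⟨ d-triangle x z u ⟩
    d x z + d z u           ∎))
    where open ≤-Reasoning

  gp-¬between : ∀ {X x y z} → IsGeneralPosition G X → x ∈ X → y ∈ X → z ∈ X →
                x ≢ y → y ≢ z → ¬ Between x y z
  gp-¬between {x = x} {y} {z} gpX x∈X y∈X z∈X x≢y y≢z xyz =
    gp-¬geodesic G gpX x∈X y∈X z∈X x≢y y≢z (between-distinct xyz x≢y) (d-walk x y) (d-walk y z)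
      (subst (Dist G x z) xyz (d-dist x z))

module Partition {n : ℕ} (G : Graph n) (d : Fin n → Fin n → ℕ) (d-dist : ∀ x y → Dist G x y (d x y))
                 {X : Subset n} (gpX : IsGeneralPosition G X) (u : Fin n) where

  open Distance G d d-dist

  Blocked : Fin n → Set
  Blocked x = ∃[ z ] (z ∈ X × z ≢ u × z ≢ x × Between x z u)

  blocked? : Decidable Blocked
  blocked? x = any? λ z → z ∈? X ×-dec ¬? (z ≟ u) ×-dec ¬? (z ≟ x) ×-dec between? x z u

  X∖u? : Decidable (λ x → x ∈ X × x ≢ u)
  X∖u? x = x ∈? X ×-dec ¬? (x ≟ u)

  unblocked? : Decidable (λ x → (x ∈ X × x ≢ u) × ¬ Blocked x)
  unblocked? x = X∖u? x ×-dec ¬? (blocked? x)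

  blocked-in-X? : Decidable (λ x → (x ∈ X × x ≢ u) × Blocked x)
  blocked-in-X? x = X∖u? x ×-dec blocked? x

  unblocked : Subset n
  unblocked = select unblocked?

  blocked : Subset n
  blocked = select blocked-in-X?

  unblocked-colinear : IsColinear G u unblocked
  unblocked-colinear =
      gp-⊆ G (proj₁ ∘ proj₁ ∘ member) gpX
    , (λ u∈ → proj₂ (proj₁ (member u∈)) refl)
    , λ x y x∈ y∈ x≢y y∈I →
        let (y∈X , y≢u) , _ = member y∈ in
        proj₂ (member x∈) (y , y∈X , y≢u , x≢y ∘ sym , interval⇒between y∈I)
    where
    member : ∀ {x} → x ∈ unblocked → (x ∈ X × x ≢ u) × ¬ Blocked x
    member = ∈-select⁻ unblocked?

  blocked-colinear : IsColinear G u blocked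
  blocked-colinear =
      gp-⊆ G (proj₁ ∘ proj₁ ∘ member) gpX
    , (λ u∈ → proj₂ (proj₁ (member u∈)) refl)
    , λ x y x∈ y∈ x≢y y∈I →
        let (x∈X , _) , _ = member x∈
            (y∈X , _) , z , z∈X , _ , z≢y , yzu = member y∈
        in gp-¬between gpX x∈X y∈X z∈X x≢y (z≢y ∘ sym) (between-trans (interval⇒between y∈I) yzu)
    where
    member : ∀ {x} → x ∈ blocked → (x ∈ X × x ≢ u) × Blocked x
    member = ∈-select⁻ blocked-in-X?

  u∈X⇒¬blocked : u ∈ X → ∀ {x} → x ∉ blocked
  u∈X⇒¬blocked u∈X x∈ =
    let (x∈X , _) , z , z∈X , z≢u , z≢x , xzu = ∈-select⁻ blocked-in-X? x∈ in
    gp-¬between gpX x∈X z∈X u∈X (z≢x ∘ sym) z≢u xzu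

  X∖u⊆unblocked∪blocked : ∀ {x} → x ∈ X → x ≢ u → x ∈ unblocked ∪ blocked
  X∖u⊆unblocked∪blocked {x} x∈X x≢u with blocked? x
  ... | no  ¬blk = x∈p∪q⁺ (inj₁ (∈-select⁺ unblocked? ((x∈X , x≢u) , ¬blk)))
  ... | yes blk  = x∈p∪q⁺ (inj₂ (∈-select⁺ blocked-in-X? ((x∈X , x≢u) , blk)))

  X⊆unblocked∪blocked : u ∉ X → X ⊆ unblocked ∪ blocked
  X⊆unblocked∪blocked u∉X x∈X = X∖u⊆unblocked∪blocked x∈X λ { refl → u∉X x∈X }

  X⊆unblocked∪⁅u⁆ : u ∈ X → X ⊆ unblocked ∪ ⁅ u ⁆
  X⊆unblocked∪⁅u⁆ u∈X {x} x∈X with x ≟ u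
  ... | yes refl = x∈p∪q⁺ (inj₂ (x∈⁅x⁆ u))
  ... | no x≢u with x∈p∪q⁻ unblocked blocked (X∖u⊆unblocked∪blocked x∈X x≢u)
  ...   | inj₁ x∈unblocked = x∈p∪q⁺ (inj₁ x∈unblocked)
  ...   | inj₂ x∈blocked   = contradiction x∈blocked (u∈X⇒¬blocked u∈X)

  ∣X∣≤2*ξ : ∀ {m} → (∀ S → IsColinear G u S → ∣ S ∣ ≤ m) → 1 ≤ m → ∣ X ∣ ≤ 2 * m
  ∣X∣≤2*ξ {m} colinear≤m 1≤m = subst (∣ X ∣ ≤_) (cong (m +_) (sym (+-identityʳ m))) (cover (u ∈? X))
    where
    cover : Dec (u ∈ X) → ∣ X ∣ ≤ m + m
    cover (yes u∈X) = ≤-trans (p⊆q∪r⇒∣p∣≤∣q∣+∣r∣ unblocked ⁅ u ⁆ (X⊆unblocked∪⁅u⁆ u∈X))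
      (+-mono-≤ (colinear≤m unblocked unblocked-colinear) (subst (_≤ m) (sym (∣⁅x⁆∣≡1 u)) 1≤m))
    cover (no u∉X) = ≤-trans (p⊆q∪r⇒∣p∣≤∣q∣+∣r∣ unblocked blocked (X⊆unblocked∪blocked u∉X))
      (+-mono-≤ (colinear≤m unblocked unblocked-colinear) (colinear≤m blocked blocked-colinear))

module _ {n : ℕ} (G : Graph n) where

  ⁅v⁆-colinear : ∀ {u v} → v ≢ u → IsColinear G u ⁅ v ⁆
  ⁅v⁆-colinear {v = v} v≢u =
      (λ _ P _ → ≤-trans (∣p∩q∣≤∣q∣ (vertices G P) ⁅ v ⁆) (subst (_≤ 2) (sym (∣⁅x⁆∣≡1 v)) (s≤s z≤n)))
    , v≢u ∘ sym ∘ x∈⁅y⁆⇒x≡y v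
    , λ x y x∈ y∈ x≢y _ → x≢y (trans (x∈⁅y⁆⇒x≡y v x∈) (sym (x∈⁅y⁆⇒x≡y v y∈)))

  ξ-positive : ∀ {u k} → 2 ≤ n → IsXiAt G u k → 1 ≤ k
  ξ-positive {u} (s≤s (s≤s _)) (_ , colinear≤k) =
    subst (_≤ _) (∣⁅x⁆∣≡1 v) (colinear≤k ⁅ v ⁆ (⁅v⁆-colinear (punchInᵢ≢i u zero)))
    where
    v : Fin n
    v = punchIn u zero

  IsMaxCard-mono : ∀ {P Q : Subset n → Set} {a b} → (∀ {S} → P S → Q S) →
                   IsMaxCard G P a → IsMaxCard G Q b → a ≤ b
  IsMaxCard-mono P⇒Q ((S , PS , refl) , _) (_ , Q≤b) = Q≤b S (P⇒Q PS)

  gp≤2*ξ⁻ : ∀ {m g} → 2 ≤ n → Connected G → IsXiMinus G m → IsGp G g → g ≤ 2 * m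
  gp≤2*ξ⁻ {m} 2≤n connected ((u , ξu) , _) ((X , gpX , refl) , _) =
    decidable-stable (∣ X ∣ ≤? 2 * m) (¬¬-map bound (¬¬-distance G connected))
    where
    bound : DistanceFunction G → ∣ X ∣ ≤ 2 * m
    bound (d , d-dist) = Partition.∣X∣≤2*ξ G d d-dist gpX u (proj₂ ξu) (ξ-positive 2≤n ξu)

theorem3p2 : (n : ℕ) → 2 ≤ n → (G : Graph n) → Connected G → (u : Fin n) →
    (m xu M g : ℕ) → IsXiMinus G m → IsXiAt G u xu → IsXi G M → IsGp G g →
    m ≤ xu × xu ≤ M × M ≤ g × g ≤ 2 * m
theorem3p2 n 2≤n G connected u m xu M g ξ⁻≡m ξu≡xu ξ≡M gp≡g =
    proj₂ ξ⁻≡m u xu ξu≡xu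
  , proj₂ ξ≡M u xu ξu≡xu
  , IsMaxCard-mono G proj₁ (proj₂ (proj₁ ξ≡M)) gp≡g
  , gp≤2*ξ⁻ G 2≤n connected ξ⁻≡m gp≡g
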